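{- Let $L$ be a finite lattice and $G$ a finite undirected graph with $\mathrm{End}(G)\cong(L,\wedge)$; for $\ell\in L$ let $R(\ell)$ be the retract of $G$ corresponding to $\ell$. Let $y\in\mathcal J(L)$ and let $C\subseteq\mathcal J(L)$ be the set of elements covered by $y$ in the poset $\mathcal J(L)$. Then $R(y)\setminus R(\bigvee C)$ is non-empty and induces a connected subgraph of $G$.
   Context: $\mathrm{End}(G)$ is the monoid of maps $V(G)\to V(G)$ sending edges to edges. A retraction is an endomorphism whose restriction to its image is the identity; when $\mathrm{End}(G)\cong(L,\wedge)$ for a lattice $L$, every endomorphism is a retraction and distinct endomorphisms have distinct images, so each $\ell\in L$ corresponds (via the fixed isomorphism) to an endomorphism whose image, the retract $R(\ell)$ (induced subgraph on its vertex set), and $\ell\leq\ell'$ iff $R(\ell)\subseteq R(\ell')$. An element $\ell$ is join-irreducible if $\bigvee I=\ell$ implies $\ell\in I$ for all $I\subseteq L$; $\mathcal J(L)$ is the subposet of join-irreducible elements. $\bigvee\varnothing=\hat 0$. In a poset, $y$ covers $x$ if $x<y$ and no $z$ satisfies $x<z<y$. -}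

module Defs where

open import Level using (0ℓ)
open import Data.Nat using (ℕ)
open import Data.Fin using (Fin)
open import Data.List using (List; foldr)
open import Data.List.Relation.Unary.Any using (Any)
open import Data.Product using (Σ; ∃; _×_; _,_)
open import Relation.Nullary using (¬_; Dec)
open import Relation.Binary.PropositionalEquality using (_≡_)
open import Relation.Binary.Lattice.Bundles using (BoundedLattice)

-- A finite (undirected) graph on the vertex set Fin n: a symmetric,
-- decidable adjacency relation (loops are allowed).
record Graph (n : ℕ) : Set₁ where
  field
    E     : Fin n → Fin n → Set
    E-sym : ∀ {u v} → E u v → E v u
    E-dec : ∀ u v → Dec (E u v)

module _ {n : ℕ} (G : Graph n) where
  open Graph G

  IsEndo : (Fin n → Fin n) → Set
  IsEndo f = ∀ u v → E u v → E (f u) (f v)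

  End : Set
  End = Σ (Fin n → Fin n) IsEndo

  data WalkIn (S : Fin n → Set) : Fin n → Fin n → Set where
    here : ∀ {u} → WalkIn S u u
    step : ∀ {u w v} → E u w → S w → WalkIn S w v → WalkIn S u v

  NonEmptyConnected : (Fin n → Set) → Set
  NonEmptyConnected S =
    (∃ λ v → S v) × (∀ u v → S u → S v → WalkIn S u v)

_≗_ : {n : ℕ} → (Fin n → Fin n) → (Fin n → Fin n) → Set
f ≗ g = ∀ x → f x ≡ g x

Image : {n : ℕ} → (Fin n → Fin n) → Fin n → Set
Image f v = ∃ λ u → f u ≡ v

module LatticeNotions (L : BoundedLattice 0ℓ 0ℓ 0ℓ) where
  open BoundedLattice L

  IsFinite : Set
  IsFinite = Σ ℕ λ k → Σ (Fin k → Carrier) λ e → ∀ x → ∃ λ i → e i ≈ x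

  _∈L_ : Carrier → List Carrier → Set
  x ∈L I = Any (x ≈_) I

  ⋁ : List Carrier → Carrier
  ⋁ = foldr _∨_ ⊥

  JoinIrreducible : Carrier → Set
  JoinIrreducible x = ∀ (I : List Carrier) → ⋁ I ≈ x → x ∈L I

  _<_ : Carrier → Carrier → Set
  x < y = x ≤ y × ¬ (x ≈ y)

  CoveredInJ : Carrier → Carrier → Set
  CoveredInJ x y =
    JoinIrreducible x × JoinIrreducible y × x < y ×
    (∀ z → JoinIrreducible z → x < z → ¬ (z < y))

  record EndIso {n : ℕ} (G : Graph n) : Set where
    field
      φ       : Carrier → End G
    map : Carrier → Fin n → Fin n
    map x = Σ.proj₁ (φ x)
    field
      φ-cong  : ∀ {x y} → x ≈ y → map x ≗ map y
      φ-inj   : ∀ {x y} → map x ≗ map y → x ≈ y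
      φ-surj  : (f : End G) → ∃ λ x → map x ≗ Σ.proj₁ f
      φ-hom   : ∀ x y → map (x ∧ y) ≗ (λ v → map x (map y v))

    R : Carrier → Fin n → Set
    R x = Image (map x)

-- Since End(G) ≅ (L, ∧), a ≤ b holds iff R a ⊆ R b. In a finite lattice every element is the
-- join of the join-irreducibles below it, and every join-irreducible strictly below y lies below
-- some lower cover of y in 𝒥(L); hence z = ⋁ C is the largest element strictly below y, and in
-- particular R z ⊊ R y. If R y ∖ R z were disconnected, folding the component A of one of its
-- vertices into R z by the retraction onto R z, while fixing the rest of R y, would again be an
-- endomorphism (edges leaving A inside R y end in R z). Its retract would lie strictly below y
-- without being contained in R z, contradicting the maximality of z.
-- Constructively, finiteness of L and of G makes every predicate involved decidable.

module Submission where

open import Defs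
open import Level using (0ℓ)
open import Data.Nat using (ℕ)
open import Data.List using (List)
open import Data.Product using (_×_)
open import Relation.Nullary using (¬_)
open import Relation.Binary.Lattice.Bundles using (BoundedLattice)

open import Data.Empty using (⊥-elim)
open import Data.Fin using (Fin; _≟_)
open import Data.Fin.Induction using (spo-wellFounded)
open import Data.Fin.Properties using (any?; all?; ¬∀⟶∃¬)
open import Data.Fin.Subset using (Subset; _∈_; _-_; ⁅_⁆; ∣_∣)
open import Data.Fin.Subset.Properties using (_∈?_; p─q⊆p; x∈p∧x≢y⇒x∈p-y; x∈p⇒∣p-x∣<∣p∣)
open import Data.List using (filter; tabulate; _∷_; [])
open import Data.List.Membership.Setoid.Properties using (∈-tabulate⁺; ∈-filter⁺; ∈-filter⁻; ∈-resp-≈)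
open import Data.List.Relation.Unary.All as All using (All; _∷_; []; tabulateₛ)
open import Data.List.Relation.Unary.All.Properties using (all-filter)
open import Data.List.Relation.Unary.Any as Any using (here; there)
import Data.Nat.Induction as ℕ
open import Data.Product using (Σ; ∃; _,_; proj₁; proj₂)
open import Data.Sum using (_⊎_; inj₁; inj₂)
import Data.Vec as Vec
open import Data.Vec.Properties using ([]=⇒lookup; lookup⇒[]=; lookup∘tabulate)
open import Function using (flip; _on_; _∘_)
open import Induction.WellFounded using (WellFounded; Acc; acc)
open import Relation.Binary.Core using (Rel)
open import Relation.Binary.Definitions using (Decidable)
open import Relation.Binary.Structures using (IsStrictPartialOrder)
import Relation.Binary.Construct.On as On
import Relation.Binary.Construct.Flip.EqAndOrd as Flip
import Relation.Binary.Construct.NonStrictToStrict as ToStrict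
open import Relation.Binary.PropositionalEquality as ≡ using (_≡_; _≢_)
open import Relation.Nullary using (Dec; yes; no; ¬?; _×-dec_; _→-dec_)
open import Relation.Nullary.Decidable as Dec using (decidable-stable; does; dec-true)

module _ {a ℓ r} {A : Set a} {_≈_ : Rel A ℓ} {_⊏_ : Rel A r}
  {k : ℕ} (enum : Fin k → A) (enum-surj : ∀ x → ∃ λ i → enum i ≈ x) where

  finite-spo-wellFounded : IsStrictPartialOrder _≈_ _⊏_ → WellFounded _⊏_
  finite-spo-wellFounded spo x =
    acc-from (proj₂ (enum-surj x)) (spo-wellFounded (On.isStrictPartialOrder enum spo) _)
    where
    open IsStrictPartialOrder spo
    acc-from : ∀ {i x} → enum i ≈ x → Acc (_⊏_ on enum) i → Acc _⊏_ x
    acc-from eᵢ (acc rs) = acc λ {z} z⊏x →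
      let j , eⱼ = enum-surj z
      in acc-from eⱼ (rs (<-respʳ-≈ (Eq.sym eᵢ) (<-respˡ-≈ (Eq.sym eⱼ) z⊏x)))

module LatticeProperties (L : BoundedLattice 0ℓ 0ℓ 0ℓ) where
  open BoundedLattice L
  open LatticeNotions L
  open import Relation.Binary.Properties.Poset poset using (<-irrefl)

  ⋁-least : ∀ {c} I → All (_≤ c) I → ⋁ I ≤ c
  ⋁-least []      []       = minimum _
  ⋁-least (_ ∷ I) (p ∷ ps) = ∨-least p (⋁-least I ps)

  ⋁-upperBound : ∀ {x} I → x ∈L I → x ≤ ⋁ I
  ⋁-upperBound (y ∷ I) (here x≈y)  = trans (reflexive x≈y) (x≤x∨y y (⋁ I))
  ⋁-upperBound (y ∷ I) (there x∈I) = trans (⋁-upperBound I x∈I) (y≤x∨y y (⋁ I))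

  joinIrreducible-resp-≈ : ∀ {x x'} → x ≈ x' → JoinIrreducible x → JoinIrreducible x'
  joinIrreducible-resp-≈ x≈x' ji I ⋁I≈x' =
    ∈-resp-≈ setoid x≈x' (ji I (Eq.trans ⋁I≈x' (Eq.sym x≈x')))

  coveredInJ⇒< : ∀ {x y} → CoveredInJ x y → x < y
  coveredInJ⇒< (_ , _ , x<y , _) = x<y

  ⋁lowerCovers< : ∀ {y C} → JoinIrreducible y →
    (∀ x → (x ∈L C → CoveredInJ x y) × (CoveredInJ x y → x ∈L C)) → ⋁ C < y
  ⋁lowerCovers< {y} {C} yJI lowerCoversInJ =
    ⋁-least C (tabulateₛ setoid λ x∈C →
      proj₁ (coveredInJ⇒< (proj₁ (lowerCoversInJ _) x∈C))) ,
    λ ⋁C≈y → <-irrefl Eq.refl (coveredInJ⇒< (proj₁ (lowerCoversInJ y) (yJI C ⋁C≈y)))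

module FiniteLattice (L : BoundedLattice 0ℓ 0ℓ 0ℓ) (finite : LatticeNotions.IsFinite L)
  (_≈?_ : Decidable (BoundedLattice._≈_ L)) where
  open BoundedLattice L
  open LatticeNotions L
  open LatticeProperties L
  open import Relation.Binary.Properties.Poset poset
    using (<-isStrictPartialOrder; <-respˡ-≈; <-respʳ-≈; <-irrefl)
  open import Relation.Binary.Lattice.Properties.MeetSemilattice meetSemilattice
    using (≈-dec⇒≤-dec)
  open ToStrict _≈_ _≤_ using (≤-<-trans)

  private
    enum = proj₁ (proj₂ finite)
    enum-surj = proj₂ (proj₂ finite)

  _<?_ : Decidable _<_
  x <? y = ≈-dec⇒≤-dec _≈?_ x y ×-dec ¬? (x ≈? y)

  <-wellFounded : WellFounded _<_
  <-wellFounded = finite-spo-wellFounded enum enum-surj <-isStrictPartialOrder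

  <-noetherian : WellFounded (flip _<_)
  <-noetherian =
    finite-spo-wellFounded enum enum-surj (Flip.isStrictPartialOrder <-isStrictPartialOrder)

  strictlyBelow : Carrier → List Carrier
  strictlyBelow x = filter (_<? x) (tabulate enum)

  strictlyBelow-< : ∀ x → All (_< x) (strictlyBelow x)
  strictlyBelow-< x = all-filter (_<? x) (tabulate enum)

  <⇒≤⋁strictlyBelow : ∀ {c x} → c < x → c ≤ ⋁ (strictlyBelow x)
  <⇒≤⋁strictlyBelow {c} {x} c<x =
    let i , eᵢ = enum-surj c
        c∈enum = ∈-resp-≈ setoid eᵢ (∈-tabulate⁺ setoid i)
    in ⋁-upperBound _ (∈-filter⁺ setoid (_<? x) <-respˡ-≈ c∈enum c<x)

  -- If x is not the join of the elements strictly below it, then any I with ⋁ I ≈ x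
  -- must contain x, since otherwise ⋁ I would lie below that join.
  joinIrreducible⊎⋁strictlyBelow≈ : ∀ x → JoinIrreducible x ⊎ ⋁ (strictlyBelow x) ≈ x
  joinIrreducible⊎⋁strictlyBelow≈ x with ⋁ (strictlyBelow x) ≈? x
  ... | yes ⋁≈x = inj₂ ⋁≈x
  ... | no  ⋁≉x = inj₁ λ I ⋁I≈x → decidable-stable (Any.any? (x ≈?_) I) λ x∉I →
    let I<x : All (_< x) I
        I<x = tabulateₛ setoid λ d∈I →
          trans (⋁-upperBound I d∈I) (reflexive ⋁I≈x) ,
          λ d≈x → x∉I (∈-resp-≈ setoid d≈x d∈I)
    in ⋁≉x (antisym (⋁-least _ (All.map proj₁ (strictlyBelow-< x)))
                    (trans (reflexive (Eq.sym ⋁I≈x))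
                           (⋁-least I (All.map <⇒≤⋁strictlyBelow I<x))))

  joinIrreducible? : ∀ x → Dec (JoinIrreducible x)
  joinIrreducible? x with joinIrreducible⊎⋁strictlyBelow≈ x
  ... | inj₁ ji   = yes ji
  ... | inj₂ ⋁≈x = no λ ji →
    <-irrefl Eq.refl
      (proj₂ (∈-filter⁻ setoid (_<? x) <-respˡ-≈ {xs = tabulate enum} (ji _ ⋁≈x)))

  joinIrreducibles-below⇒≤ : ∀ {x c} → (∀ j → JoinIrreducible j → j ≤ x → j ≤ c) → x ≤ c
  joinIrreducibles-below⇒≤ = go (<-wellFounded _)
    where
    go : ∀ {x c} → Acc _<_ x → (∀ j → JoinIrreducible j → j ≤ x → j ≤ c) → x ≤ c
    go {x} (acc rs) below with joinIrreducible⊎⋁strictlyBelow≈ x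
    ... | inj₁ ji   = below x ji refl
    ... | inj₂ ⋁≈x = trans (reflexive (Eq.sym ⋁≈x)) (⋁-least _ (All.map
      (λ d<x → go (rs d<x) λ j ji j≤d → below j ji (trans j≤d (proj₁ d<x)))
      (strictlyBelow-< x)))

  coveredInJ-above : ∀ {y j} → JoinIrreducible y → JoinIrreducible j → j < y →
                     ∃ λ c → CoveredInJ c y × j ≤ c
  coveredInJ-above {y} yJI = go (<-noetherian _)
    where
    go : ∀ {j} → Acc (flip _<_) j → JoinIrreducible j → j < y → ∃ λ c → CoveredInJ c y × j ≤ c
    go {j} (acc rs) jJI j<y
      with any? (λ i → joinIrreducible? (enum i) ×-dec j <? enum i ×-dec enum i <? y)
    ... | yes (i , iJI , j<i , i<y) =
      let c , c⋖y , i≤c = go (rs j<i) iJI i<y in c , c⋖y , trans (proj₁ j<i) i≤c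
    ... | no ∄ = j , (jJI , yJI , j<y , nothingBetween) , refl
      where
      nothingBetween : ∀ z → JoinIrreducible z → j < z → ¬ (z < y)
      nothingBetween z zJI j<z z<y =
        let i , eᵢ = enum-surj z
        in ∄ (i , joinIrreducible-resp-≈ (Eq.sym eᵢ) zJI ,
                  <-respʳ-≈ (Eq.sym eᵢ) j<z , <-respˡ-≈ (Eq.sym eᵢ) z<y)

  <⇒≤⋁lowerCovers : ∀ {y C} → JoinIrreducible y →
    (∀ x → (x ∈L C → CoveredInJ x y) × (CoveredInJ x y → x ∈L C)) → ∀ {w} → w < y → w ≤ ⋁ C
  <⇒≤⋁lowerCovers {C = C} yJI lowerCoversInJ w<y = joinIrreducibles-below⇒≤ λ j jJI j≤w →
    let c , c⋖y , j≤c = coveredInJ-above yJI jJI (≤-<-trans trans antisym ≤-respˡ-≈ j≤w w<y)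
    in trans j≤c (⋁-upperBound C (proj₂ (lowerCoversInJ c) c⋖y))

toSubset : ∀ {n} {P : Fin n → Set} → (∀ i → Dec (P i)) → Subset n
toSubset P? = Vec.tabulate (does ∘ P?)

module _ {n} {P : Fin n → Set} (P? : ∀ i → Dec (P i)) where

  ∈-toSubset⁺ : ∀ {i} → P i → i ∈ toSubset P?
  ∈-toSubset⁺ {i} Pi =
    lookup⇒[]= i _ (≡.trans (lookup∘tabulate (does ∘ P?) i) (dec-true (P? i) Pi))

  ∈-toSubset⁻ : ∀ {i} → i ∈ toSubset P? → P i
  ∈-toSubset⁻ {i} i∈ with P? i | ≡.trans (≡.sym (lookup∘tabulate (does ∘ P?) i)) ([]=⇒lookup i∈)
  ... | yes Pi | _  = Pi
  ... | no  _  | ()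

module Walks {n : ℕ} (G : Graph n) where
  open Graph G

  WalkIn-mono : ∀ {S T : Fin n → Set} → (∀ {t} → S t → T t) →
                ∀ {u v} → WalkIn G S u v → WalkIn G T u v
  WalkIn-mono S⊆T here           = here
  WalkIn-mono S⊆T (step e Sw W) = step e (S⊆T Sw) (WalkIn-mono S⊆T W)

  WalkIn-snoc : ∀ {S u a b} → WalkIn G S u a → E a b → S b → WalkIn G S u b
  WalkIn-snoc here           e Sb = step e Sb here
  WalkIn-snoc (step e' Sw W) e Sb = step e' Sw (WalkIn-snoc W e Sb)

  avoiding⊎restarted : ∀ {S} w {a v} → WalkIn G S a v →
    WalkIn G (λ t → S t × t ≢ w) a v ⊎ WalkIn G (λ t → S t × t ≢ w) w v
  avoiding⊎restarted w here = inj₁ here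
  avoiding⊎restarted w (step {w = x} e Sx W) with avoiding⊎restarted w W
  ... | inj₂ W' = inj₂ W'
  ... | inj₁ W' with x ≟ w
  ...   | yes ≡.refl = inj₂ W'
  ...   | no  x≢w    = inj₁ (step e (Sx , x≢w) W')

  avoidingStart : ∀ {S w v} → WalkIn G S w v → WalkIn G (λ t → S t × t ≢ w) w v
  avoidingStart {w = w} W with avoiding⊎restarted w W
  ... | inj₁ W' = W'
  ... | inj₂ W' = W'

  walkInSubset? : ∀ (p : Subset n) u v → Dec (WalkIn G (_∈ p) u v)
  walkInSubset? p = search (ℕ.<-wellFounded ∣ p ∣)
    where
    -- After the first step w the rest of a walk can be taken to avoid w, so ∣ p ∣ decreases.
    search : ∀ {p} → Acc Data.Nat._<_ ∣ p ∣ → ∀ u v → Dec (WalkIn G (_∈ p) u v)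
    search {p} (acc rs) u v with u ≟ v
    ... | yes ≡.refl = yes here
    ... | no  u≢v    = Dec.map′
      (λ (w , e , w∈p , W) → step e w∈p (WalkIn-mono (p─q⊆p p ⁅ w ⁆) W))
      (λ { here → ⊥-elim (u≢v ≡.refl)
         ; (step {w = w} e w∈p W) → w , e , w∈p ,
             WalkIn-mono (λ (t∈p , t≢w) → x∈p∧x≢y⇒x∈p-y t∈p t≢w) (avoidingStart W) })
      (any? firstStep?)
      where
      firstStep? : ∀ w → Dec (E u w × Σ (w ∈ p) λ _ → WalkIn G (_∈ p - w) w v)
      firstStep? w with w ∈? p
      ... | no  w∉p = no (w∉p ∘ proj₁ ∘ proj₂)
      ... | yes w∈p = Dec.map′ (λ (e , W) → e , w∈p , W) (λ (e , _ , W) → e , W)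
        (E-dec u w ×-dec search (rs (x∈p⇒∣p-x∣<∣p∣ w∈p)) w v)

  walkIn? : ∀ {S : Fin n → Set} → (∀ t → Dec (S t)) → ∀ u v → Dec (WalkIn G S u v)
  walkIn? S? u v = Dec.map′ (WalkIn-mono (∈-toSubset⁻ S?)) (WalkIn-mono (∈-toSubset⁺ S?))
    (walkInSubset? (toSubset S?) u v)

module Retracts (L : BoundedLattice 0ℓ 0ℓ 0ℓ) {n} {G : Graph n} (iso : LatticeNotions.EndIso L G) where
  open BoundedLattice L
  open LatticeNotions L
  open LatticeNotions.EndIso iso
  open Graph G
  open Walks G
  open import Relation.Binary.Lattice.Properties.MeetSemilattice meetSemilattice
    using (y≤x⇒x∧y≈y)

  ≤⇒map-absorbs : ∀ {a b} → a ≤ b → ∀ v → map b (map a v) ≡ map a v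
  ≤⇒map-absorbs {a} {b} a≤b v = ≡.trans (≡.sym (φ-hom b a v)) (φ-cong (y≤x⇒x∧y≈y a≤b) v)

  R-fixed : ∀ {a t} → R a t → map a t ≡ t
  R-fixed {a} (s , ≡.refl) = ≤⇒map-absorbs refl s

  ≤⇒R⊆ : ∀ {a b t} → a ≤ b → R a t → R b t
  ≤⇒R⊆ a≤b (s , ≡.refl) = _ , ≤⇒map-absorbs a≤b s

  R⊆⇒≤ : ∀ {a b} → (∀ {t} → R a t → R b t) → a ≤ b
  R⊆⇒≤ {a} {b} Ra⊆Rb = trans (reflexive (Eq.sym b∧a≈a)) (x∧y≤x b a)
    where
    b∧a≈a : b ∧ a ≈ a
    b∧a≈a = φ-inj λ v → ≡.trans (φ-hom b a v) (R-fixed (Ra⊆Rb (v , ≡.refl)))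

  _≈?_ : Decidable _≈_
  a ≈? b = Dec.map′ φ-inj φ-cong (all? λ v → map a v ≟ map b v)

  R? : ∀ a t → Dec (R a t)
  R? a t = any? λ s → map a s ≟ t

  <⇒R-difference : ∀ {a b} → a < b → ∃ λ t → R b t × ¬ R a t
  <⇒R-difference {a} {b} (a≤b , a≉b) with ¬∀⟶∃¬ n _ (λ t → R? b t →-dec R? a t)
                                            (λ Rb⊆Ra → a≉b (antisym a≤b (R⊆⇒≤ (Rb⊆Ra _))))
  ... | t , Rb⊈Ra with R? b t
  ...   | yes Rbt = t , Rbt , λ Rat → Rb⊈Ra λ _ → Rat
  ...   | no ¬Rbt = ⊥-elim (Rb⊈Ra λ Rbt → ⊥-elim (¬Rbt Rbt))

  module Collapse {z y} (z≤y : z ≤ y) {A : Fin n → Set} (A? : ∀ t → Dec (A t))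
    (A⊆R∖R : ∀ {t} → A t → R y t × ¬ R z t)
    (A-closed : ∀ {t t'} → A t → E t t' → R y t' → ¬ R z t' → A t') where

    collapse : Fin n → Fin n
    collapse t with A? t
    ... | yes _ = map z t
    ... | no  _ = t

    collapse-inside : ∀ {t} → A t → collapse t ≡ map z t
    collapse-inside {t} At with A? t
    ... | yes _  = ≡.refl
    ... | no ¬At = ⊥-elim (¬At At)

    collapse-outside : ∀ {t} → ¬ A t → collapse t ≡ t
    collapse-outside {t} ¬At with A? t
    ... | yes At = ⊥-elim (¬At At)
    ... | no  _  = ≡.refl

    boundary⊆Rz : ∀ {t t'} → A t → ¬ A t' → R y t' → E t t' → R z t'
    boundary⊆Rz At ¬At' Ryt' e =
      decidable-stable (R? z _) λ ¬Rzt' → ¬At' (A-closed At e Ryt' ¬Rzt')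

    collapse-edge : ∀ {t t'} → R y t → R y t' → E t t' → E (collapse t) (collapse t')
    collapse-edge {t} {t'} Ryt Ryt' e with A? t | A? t'
    ... | yes _  | yes _   = proj₂ (φ z) t t' e
    ... | yes At | no ¬At' =
      ≡.subst (E (map z t)) (R-fixed (boundary⊆Rz At ¬At' Ryt' e)) (proj₂ (φ z) t t' e)
    ... | no ¬At | yes At' =
      ≡.subst (λ s → E s (map z t')) (R-fixed (boundary⊆Rz At' ¬At Ryt (E-sym e)))
        (proj₂ (φ z) t t' e)
    ... | no _   | no _    = e

    collapse-R : ∀ {t} → R y t → R y (collapse t)
    collapse-R {t} Ryt with A? t
    ... | yes _ = ≤⇒R⊆ z≤y (t , ≡.refl)
    ... | no  _ = Ryt

    collapsed : Carrier
    collapsed = proj₁ (φ-surj (collapse ∘ map y , λ u v e →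
      collapse-edge (u , ≡.refl) (v , ≡.refl) (proj₂ (φ y) u v e)))

    map-collapsed : ∀ v → map collapsed v ≡ collapse (map y v)
    map-collapsed = proj₂ (φ-surj _)

    collapsed≤y : collapsed ≤ y
    collapsed≤y = R⊆⇒≤ λ { (s , ≡.refl) →
      ≡.subst (R y) (≡.sym (map-collapsed s)) (collapse-R (s , ≡.refl)) }

    R∖A⊆Rcollapsed : ∀ {t} → R y t → ¬ A t → R collapsed t
    R∖A⊆Rcollapsed {t} Ryt ¬At = t , (begin
      map collapsed t      ≡⟨ map-collapsed t ⟩
      collapse (map y t)   ≡⟨ ≡.cong collapse (R-fixed Ryt) ⟩
      collapse t           ≡⟨ collapse-outside ¬At ⟩
      t                    ∎)
      where open ≡.≡-Reasoning

    A∉Rcollapsed : ∀ {t} → A t → ¬ R collapsed t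
    A∉Rcollapsed {t} At Rct = proj₂ (A⊆R∖R At) (t , (begin
      map z t              ≡⟨ collapse-inside At ⟨
      collapse t           ≡⟨ ≡.cong collapse (R-fixed (proj₁ (A⊆R∖R At))) ⟨
      collapse (map y t)   ≡⟨ map-collapsed t ⟨
      map collapsed t      ≡⟨ R-fixed Rct ⟩
      t                    ∎))
      where open ≡.≡-Reasoning

  R∖R-nonEmptyConnected : ∀ {z y} → z < y → (∀ {w} → w < y → w ≤ z) →
                          NonEmptyConnected G (λ t → R y t × ¬ R z t)
  R∖R-nonEmptyConnected {z} {y} z<y below-y⇒≤z = <⇒R-difference z<y , connected
    where
    S? : ∀ t → Dec (R y t × ¬ R z t)
    S? t = R? y t ×-dec ¬? (R? z t)

    connected : ∀ u v → R y u × ¬ R z u → R y v × ¬ R z v → WalkIn G _ u v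
    connected u v Su Sv with walkIn? S? u v
    ... | yes W  = W
    ... | no  ¬W = ⊥-elim (proj₂ Sv
      (≤⇒R⊆ (below-y⇒≤z collapsed<y) (R∖A⊆Rcollapsed (proj₁ Sv) (¬W ∘ proj₂))))
      where
      open Collapse (proj₁ z<y) (λ t → S? t ×-dec walkIn? S? u t) proj₁
        (λ (_ , W) e Ryt' ¬Rzt' → (Ryt' , ¬Rzt') , WalkIn-snoc W e (Ryt' , ¬Rzt'))
      collapsed<y : collapsed < y
      collapsed<y = collapsed≤y ,
        λ c≈y → A∉Rcollapsed (Su , here) (≤⇒R⊆ (reflexive (Eq.sym c≈y)) (proj₁ Su))

lemma26 : (L : BoundedLattice 0ℓ 0ℓ 0ℓ) → LatticeNotions.IsFinite L →
    {n : ℕ} (G : Graph n) (iso : LatticeNotions.EndIso L G) →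
    (y : BoundedLattice.Carrier L) → LatticeNotions.JoinIrreducible L y →
    (C : List (BoundedLattice.Carrier L)) →
    (∀ x → (LatticeNotions._∈L_ L x C → LatticeNotions.CoveredInJ L x y)
         × (LatticeNotions.CoveredInJ L x y → LatticeNotions._∈L_ L x C)) →
    NonEmptyConnected G (λ v → LatticeNotions.EndIso.R iso y v
                             × ¬ LatticeNotions.EndIso.R iso (LatticeNotions.⋁ L C) v)
lemma26 L finite G iso y yJI C lowerCoversInJ =
  R∖R-nonEmptyConnected (⋁lowerCovers< yJI lowerCoversInJ) (<⇒≤⋁lowerCovers yJI lowerCoversInJ)
  where
  open Retracts L iso
  open LatticeProperties L
  open FiniteLattice L finite _≈?_
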